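{- Let $a,b,n,s$ be natural numbers with $b<a<n$ and $0<s<n$. Then \[ s^2-(1+a+b)s+nb\geq 0 \] if and only if \[ k^2-k(1+2b)+nb+bs-as\geq 0 \quad\text{for all } k\in\{s,s+1,\dots,n\}. \] -}

-- As a polynomial in k, the second expression is Q(k) = k² − (1 + 2b)k + nb + bs − as, and Q(s) is
-- exactly the first expression; so the condition at k = s is the backward direction. Completing
-- the square around the integer vertex b, Q(k) = Q(j) + (k − j)(k − j − 1) + 2(j − b)(k − j) for
-- every j, and a product of two consecutive integers is never negative. If b ≤ s this shows Q is
-- non-decreasing from s on. If s < b, taking j = b gives Q(k) ≥ Q(b) = b(n − 1 − a) + (b − s)(a − b),
-- which is non-negative by b < a < n, whatever the sign of Q(s).
module Submission where

open import Data.Nat using (ℕ; _<_; _≤_; z≤n)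
import Data.Nat.Properties as ℕ
open import Data.Integer
  using (ℤ; +_; -[1+_]; +≤+; _+_; _-_; _*_; 0ℤ) renaming (_≤_ to _≤ℤ_)
open import Data.Integer.Properties
  using (i≤j⇒0≤j-i; *-monoʳ-≤-nonNeg; +-mono-≤)
open import Data.Integer.Tactic.RingSolver using (solve-∀)
open import Data.Sum using (inj₁; inj₂)
open import Function.Bundles using (_⇔_; mk⇔)
open import Relation.Binary.PropositionalEquality using (_≡_; subst; sym)

0≤i⇒0≤j⇒0≤i*j : ∀ {i j} → 0ℤ ≤ℤ i → 0ℤ ≤ℤ j → 0ℤ ≤ℤ i * j
0≤i⇒0≤j⇒0≤i*j {j = + n} 0≤i _ = *-monoʳ-≤-nonNeg (+ n) 0≤i

0≤i*[i-1] : ∀ i → 0ℤ ≤ℤ i * (i - + 1)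
0≤i*[i-1] (+ 0)       = +≤+ z≤n
0≤i*[i-1] (+ ℕ.suc m) = 0≤i⇒0≤j⇒0≤i*j {+ ℕ.suc m} {+ m} (+≤+ z≤n) (+≤+ z≤n)
0≤i*[i-1] -[1+ m ]    = +≤+ z≤n

Q : (a b n s k : ℤ) → ℤ
Q a b n s k = k * k - k * (+ 1 + + 2 * b) + n * b + b * s - a * s

Q-shift : ∀ a b n s j k →
          Q a b n s k ≡ Q a b n s j + (k - j) * (k - j - + 1) + + 2 * (j - b) * (k - j)
Q-shift = ring
  where
  ring : ∀ a b n s j k →
         k * k - k * (+ 1 + + 2 * b) + n * b + b * s - a * s
         ≡ (j * j - j * (+ 1 + + 2 * b) + n * b + b * s - a * s)
           + (k - j) * (k - j - + 1) + + 2 * (j - b) * (k - j)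
  ring = solve-∀

Q-at-s : ∀ a b n s → Q a b n s s ≡ s * s - (+ 1 + a + b) * s + n * b
Q-at-s = ring
  where
  ring : ∀ a b n s →
         s * s - s * (+ 1 + + 2 * b) + n * b + b * s - a * s ≡ s * s - (+ 1 + a + b) * s + n * b
  ring = solve-∀

Q-from-vertex : ∀ a b n s k → Q a b n s k ≡ Q a b n s b + (k - b) * (k - b - + 1)
Q-from-vertex = ring
  where
  ring : ∀ a b n s k →
         k * k - k * (+ 1 + + 2 * b) + n * b + b * s - a * s
         ≡ (b * b - b * (+ 1 + + 2 * b) + n * b + b * s - a * s) + (k - b) * (k - b - + 1)
  ring = solve-∀

Q-at-vertex : ∀ a b n s → Q a b n s b ≡ b * (n - (+ 1 + a)) + (b - s) * (a - b)
Q-at-vertex = ring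
  where
  ring : ∀ a b n s →
         b * b - b * (+ 1 + + 2 * b) + n * b + b * s - a * s ≡ b * (n - (+ 1 + a)) + (b - s) * (a - b)
  ring = solve-∀

0≤Q[j]⇒0≤Q[k] : ∀ {a b n s j k} → b ≤ℤ j → j ≤ℤ k → 0ℤ ≤ℤ Q a b n s j → 0ℤ ≤ℤ Q a b n s k
0≤Q[j]⇒0≤Q[k] {a} {b} {n} {s} {j} {k} b≤j j≤k 0≤Q[j] =
  subst (0ℤ ≤ℤ_) (sym (Q-shift a b n s j k))
    (+-mono-≤ (+-mono-≤ 0≤Q[j] (0≤i*[i-1] (k - j)))
      (0≤i⇒0≤j⇒0≤i*j (0≤i⇒0≤j⇒0≤i*j {+ 2} (+≤+ z≤n) (i≤j⇒0≤j-i b≤j)) (i≤j⇒0≤j-i j≤k)))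

s≤b⇒0≤Q : ∀ {a b n s} k → 0ℤ ≤ℤ b → s ≤ℤ b → b ≤ℤ a → + 1 + a ≤ℤ n → 0ℤ ≤ℤ Q a b n s k
s≤b⇒0≤Q {a} {b} {n} {s} k 0≤b s≤b b≤a a<n =
  subst (0ℤ ≤ℤ_) (sym (Q-from-vertex a b n s k))
    (+-mono-≤ 0≤Q[b] (0≤i*[i-1] (k - b)))
  where
  0≤Q[b] : 0ℤ ≤ℤ Q a b n s b
  0≤Q[b] = subst (0ℤ ≤ℤ_) (sym (Q-at-vertex a b n s))
    (+-mono-≤ (0≤i⇒0≤j⇒0≤i*j 0≤b (i≤j⇒0≤j-i a<n))
      (0≤i⇒0≤j⇒0≤i*j (i≤j⇒0≤j-i s≤b) (i≤j⇒0≤j-i b≤a)))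

lemma5 : (a b n s : ℕ) → b < a → a < n → 0 < s → s < n →
         (0ℤ ≤ℤ ((+ s) * (+ s) - (+ 1 + + a + + b) * (+ s) + (+ n) * (+ b)))
         ⇔ ((k : ℕ) → s ≤ k → k ≤ n →
             0ℤ ≤ℤ ((+ k) * (+ k) - (+ k) * (+ 1 + + 2 * + b) + (+ n) * (+ b) + (+ b) * (+ s) - (+ a) * (+ s)))
lemma5 a b n s b<a a<n _ s<n = mk⇔ forward backward
  where
  forward : 0ℤ ≤ℤ + s * + s - (+ 1 + + a + + b) * + s + + n * + b →
            (k : ℕ) → s ≤ k → k ≤ n → 0ℤ ≤ℤ Q (+ a) (+ b) (+ n) (+ s) (+ k)
  forward 0≤Q[s] k s≤k _ with ℕ.≤-total b s
  ... | inj₁ b≤s = 0≤Q[j]⇒0≤Q[k] {+ a} {+ b} {+ n} (+≤+ b≤s) (+≤+ s≤k)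
                     (subst (0ℤ ≤ℤ_) (sym (Q-at-s (+ a) (+ b) (+ n) (+ s))) 0≤Q[s])
  ... | inj₂ s≤b = s≤b⇒0≤Q {+ a} {+ b} {+ n} (+ k) (+≤+ z≤n) (+≤+ s≤b) (+≤+ (ℕ.<⇒≤ b<a)) (+≤+ a<n)

  backward : ((k : ℕ) → s ≤ k → k ≤ n → 0ℤ ≤ℤ Q (+ a) (+ b) (+ n) (+ s) (+ k)) →
             0ℤ ≤ℤ + s * + s - (+ 1 + + a + + b) * + s + + n * + b
  backward 0≤Q-from-s = subst (0ℤ ≤ℤ_) (Q-at-s (+ a) (+ b) (+ n) (+ s)) (0≤Q-from-s s ℕ.≤-refl (ℕ.<⇒≤ s<n))
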